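{- Let $P=\begin{bmatrix}a&b\\ c&d\end{bmatrix}$ with $a,b,c,d\in\mathbb{Z}$, $|c|\ge2$, $|d|\ge 2$, $b\ne0$, $\det P=\pm1$, and $$0\le\frac{|a|}{|b|},\ \frac{|c|}{|d|},\ \frac{|a|}{|c|},\ \frac{|b|}{|d|}\le1.$$ For $i\in\mathbb{N}$ write $P^i=\begin{bmatrix}a_i&b_i\\ c_i&d_i\end{bmatrix}$. Then for all $i\ge2$: $|d_i|-|b_i|\ge|d_{i-1}|-|b_{i-1}|$, $|d_i|-|c_i|\ge|d_{i-1}|-|c_{i-1}|$, $|b_i|-|a_i|\ge(|b|-|a|)(|b_{i-1}|-|a_{i-1}|)$, and $|d_i|>|d_{i-1}|$. -}

module Defs where

open import Data.Nat using (ℕ; zero; suc)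
open import Data.Integer using (ℤ; _+_; _*_; _-_; +_; ∣_∣)

record Mat2 : Set where
  constructor mat
  field
    a b c d : ℤ
open Mat2 public

_⊗_ : Mat2 → Mat2 → Mat2
mat a₁ b₁ c₁ d₁ ⊗ mat a₂ b₂ c₂ d₂ =
  mat (a₁ * a₂ + b₁ * c₂) (a₁ * b₂ + b₁ * d₂)
      (c₁ * a₂ + d₁ * c₂) (c₁ * b₂ + d₁ * d₂)

I₂ : Mat2
I₂ = mat (+ 1) (+ 0) (+ 0) (+ 1)

_^ᴹ_ : Mat2 → ℕ → Mat2
P ^ᴹ zero = I₂
P ^ᴹ suc i = P ⊗ (P ^ᴹ i)

det : Mat2 → ℤ
det (mat a b c d) = a * d - b * c

abs : ℤ → ℤ
abs x = + ∣ x ∣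

-- Replacing P by -P, or by its conjugate diag(1,-1) P diag(1,-1), changes no absolute value of
-- any entry of any power, so we may assume b, d ≥ 0.  The determinant condition then forces a and
-- c to have the same sign, so P = |P| or P = |P| diag(-1,1), and in both cases |P^(j+1)| = P^j |P|.
-- These matrices have the shape [[x, x+p], [x+q, x+p+q+r]] with x, p, q, r ≥ 0 and q + r ≥ 1:
-- for |P| this is where det P = ±1 is used, and left multiplication by P maps (x, p, q, r) to
-- combinations with coefficients a+b, b, (c+d)-(a+b), d-b, all nonnegative.  So the shape
-- propagates, and every claimed inequality says that a difference is a nonnegative combination
-- of x, p, q, r.

module Submission where

open import Defs
open import Data.Nat as ℕ using (ℕ; zero; suc; z≤n; s≤s) renaming (_≤_ to _≤ℕ_)
open import Data.Nat.Properties using (m≤n*m; m≤n+m) renaming (≤-trans to ≤ℕ-trans)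
open import Data.Integer using (ℤ; _*_; _-_; -_; +_; _≤_; _<_; _+_; ∣_∣; -[1+_]; +≤+; -≤-; 0ℤ; nonNegative)
open import Data.Integer.Properties
  using ( ≤-refl; i≤j⇒i≤k+j; drop‿+≤+; ≤-trans; <⇒≤; ≰⇒>; _≤?_; +-mono-≤; +-injective; +-inverseˡ
        ; pos-+; pos-*; neg-involutive; ∣-i∣≡∣i∣; ∣i∣≡0⇒i≡0; 0≤i⇒+∣i∣≡i
        ; i≤j⇒0≤j-i; 0≤i-j⇒j≤i; i<j⇒suc[i]≤j; suc[i]≤j⇒i<j )
open import Data.Integer.Tactic.RingSolver using (solve-∀)
open import Data.Product using (_×_; _,_; proj₁; proj₂)
open import Data.Sum using (_⊎_; inj₁; inj₂)
open import Relation.Binary.PropositionalEquality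
  using (_≡_; _≢_; refl; sym; trans; cong; cong₂; subst; subst₂; module ≡-Reasoning)
open import Relation.Nullary using (¬_; yes; no; contradiction)

IsUnit : ℤ → Set
IsUnit x = x ≡ + 1 ⊎ x ≡ - (+ 1)

IsUnit-neg : ∀ {x} → IsUnit (- x) → IsUnit x
IsUnit-neg {x} (inj₁ e) = inj₂ (trans (sym (neg-involutive x)) (cong -_ e))
IsUnit-neg {x} (inj₂ e) = inj₁ (trans (sym (neg-involutive x)) (cong -_ e))

unit≢0 : ¬ IsUnit 0ℤ
unit≢0 (inj₁ ())
unit≢0 (inj₂ ())

unit≰-2 : ∀ {x} → IsUnit x → ¬ (x ≤ - (+ 2))
unit≰-2 (inj₁ refl) ()
unit≰-2 (inj₂ refl) (-≤- ())

2≰unit : ∀ {x} → IsUnit x → ¬ (+ 2 ≤ x)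
2≰unit (inj₁ refl) (+≤+ (s≤s ()))
2≰unit (inj₂ refl) ()

0≤+ : ∀ {i j} → 0ℤ ≤ i → 0ℤ ≤ j → 0ℤ ≤ i + j
0≤+ = +-mono-≤

0≤* : ∀ {i j} → 0ℤ ≤ i → 0ℤ ≤ j → 0ℤ ≤ i * j
0≤* {+ m} {+ n} _ _ = subst (0ℤ ≤_) (pos-* m n) (+≤+ z≤n)

0≤i+∣i∣ : ∀ i → 0ℤ ≤ i + + ∣ i ∣
0≤i+∣i∣ (+ n)    = +≤+ z≤n
0≤i+∣i∣ -[1+ n ] = subst (0ℤ ≤_) (sym (+-inverseˡ (+ suc n))) ≤-refl

≤-by : ∀ {i j k} → j - i ≡ k → 0ℤ ≤ k → i ≤ j
≤-by j-i≡k 0≤k = 0≤i-j⇒j≤i (subst (0ℤ ≤_) (sym j-i≡k) 0≤k)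

<-by : ∀ {i j k} → j - (+ 1 + i) ≡ k → 0ℤ ≤ k → i < j
<-by j-i-1≡k 0≤k = suc[i]≤j⇒i<j (≤-by j-i-1≡k 0≤k)

<⇒0≤-1 : ∀ {i j} → i < j → 0ℤ ≤ j - (+ 1 + i)
<⇒0≤-1 i<j = i≤j⇒0≤j-i (i<j⇒suc[i]≤j i<j)

<-by-gap : ∀ {i j g} → j - i ≡ g → + 1 ≤ g → i < j
<-by-gap {i} {j} j-i≡g 1≤g = <-by (trans (shift i j) (cong (_- + 1) j-i≡g)) (i≤j⇒0≤j-i 1≤g)
  where
  shift : ∀ i j → j - (+ 1 + i) ≡ (j - i) - + 1
  shift = solve-∀

∣b∣-∣a∣≤a+b : ∀ a b → 0ℤ ≤ b → + ∣ b ∣ - + ∣ a ∣ ≤ a + b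
∣b∣-∣a∣≤a+b a b 0≤b rewrite 0≤i⇒+∣i∣≡i 0≤b = ≤-by (difference a b (+ ∣ a ∣)) (0≤i+∣i∣ a)
  where
  difference : ∀ a b A → (a + b) - (b - A) ≡ a + A
  difference = solve-∀

mat-≡ : ∀ {a₁ b₁ c₁ d₁ a₂ b₂ c₂ d₂} → a₁ ≡ a₂ → b₁ ≡ b₂ → c₁ ≡ c₂ → d₁ ≡ d₂ →
        mat a₁ b₁ c₁ d₁ ≡ mat a₂ b₂ c₂ d₂
mat-≡ refl refl refl refl = refl

⊗-identityˡ : ∀ M → I₂ ⊗ M ≡ M
⊗-identityˡ (mat a b c d) = mat-≡ (unit a c) (unit b d) (unit′ a c) (unit′ b d)
  where
  unit : ∀ x y → + 1 * x + + 0 * y ≡ x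
  unit = solve-∀
  unit′ : ∀ x y → + 0 * x + + 1 * y ≡ y
  unit′ = solve-∀

⊗-identityʳ : ∀ M → M ⊗ I₂ ≡ M
⊗-identityʳ (mat a b c d) = mat-≡ (unit a b) (unit′ a b) (unit c d) (unit′ c d)
  where
  unit : ∀ x y → x * + 1 + y * + 0 ≡ x
  unit = solve-∀
  unit′ : ∀ x y → x * + 0 + y * + 1 ≡ y
  unit′ = solve-∀

⊗-assoc : ∀ L M N → (L ⊗ M) ⊗ N ≡ L ⊗ (M ⊗ N)
⊗-assoc (mat a₁ b₁ c₁ d₁) (mat a₂ b₂ c₂ d₂) (mat a₃ b₃ c₃ d₃) =
  mat-≡ (entry a₁ b₁ a₂ b₂ c₂ d₂ a₃ c₃) (entry a₁ b₁ a₂ b₂ c₂ d₂ b₃ d₃)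
        (entry c₁ d₁ a₂ b₂ c₂ d₂ a₃ c₃) (entry c₁ d₁ a₂ b₂ c₂ d₂ b₃ d₃)
  where
  entry : ∀ x y a b c d z w → (x * a + y * c) * z + (x * b + y * d) * w ≡
                              x * (a * z + b * w) + y * (c * z + d * w)
  entry = solve-∀

^ᴹ-suc-factor : ∀ {P Q S} → P ≡ Q ⊗ S → ∀ j → P ^ᴹ suc j ≡ ((P ^ᴹ j) ⊗ Q) ⊗ S
^ᴹ-suc-factor {P} {Q} {S} P≡Q⊗S zero = begin
  P ⊗ I₂         ≡⟨ ⊗-identityʳ P ⟩
  P              ≡⟨ P≡Q⊗S ⟩
  Q ⊗ S          ≡⟨ cong (_⊗ S) (sym (⊗-identityˡ Q)) ⟩
  (I₂ ⊗ Q) ⊗ S   ∎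
  where open ≡-Reasoning
^ᴹ-suc-factor {P} {Q} {S} P≡Q⊗S (suc j) = begin
  P ⊗ (P ^ᴹ suc j)             ≡⟨ cong (P ⊗_) (^ᴹ-suc-factor P≡Q⊗S j) ⟩
  P ⊗ (((P ^ᴹ j) ⊗ Q) ⊗ S)     ≡⟨ sym (⊗-assoc P ((P ^ᴹ j) ⊗ Q) S) ⟩
  (P ⊗ ((P ^ᴹ j) ⊗ Q)) ⊗ S     ≡⟨ cong (_⊗ S) (sym (⊗-assoc P (P ^ᴹ j) Q)) ⟩
  ((P ⊗ (P ^ᴹ j)) ⊗ Q) ⊗ S     ∎
  where open ≡-Reasoning

∣_∣ᴹ : Mat2 → Mat2
∣ M ∣ᴹ = mat (abs (a M)) (abs (b M)) (abs (c M)) (abs (d M))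

J : Mat2
J = mat (- (+ 1)) (+ 0) (+ 0) (+ 1)

⊗-J : ∀ M → M ⊗ J ≡ mat (- a M) (b M) (- c M) (d M)
⊗-J (mat a b c d) = mat-≡ (flip a b) (keep a b) (flip c d) (keep c d)
  where
  flip : ∀ x y → x * - (+ 1) + y * + 0 ≡ - x
  flip = solve-∀
  keep : ∀ x y → x * + 0 + y * + 1 ≡ y
  keep = solve-∀

∣⊗J∣ᴹ : ∀ M → ∣ M ⊗ J ∣ᴹ ≡ ∣ M ∣ᴹ
∣⊗J∣ᴹ M = trans (cong ∣_∣ᴹ (⊗-J M)) (mat-≡ (cong +_ (∣-i∣≡∣i∣ (a M))) refl (cong +_ (∣-i∣≡∣i∣ (c M))) refl)

∣⊗I₂∣ᴹ : ∀ M → ∣ M ⊗ I₂ ∣ᴹ ≡ ∣ M ∣ᴹ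
∣⊗I₂∣ᴹ M = cong ∣_∣ᴹ (⊗-identityʳ M)

-- Growth along the orbit of a nonnegative matrix

record Increasing (Q : Mat2) : Set where
  field
    0≤a     : 0ℤ ≤ a Q
    a≤b     : a Q ≤ b Q
    a≤c     : a Q ≤ c Q
    b+c≤a+d : b Q + c Q ≤ a Q + d Q
    b<d     : b Q < d Q

record Admissible (P : Mat2) : Set where
  field
    0≤b     : 0ℤ ≤ b P
    0≤a+b   : 0ℤ ≤ a P + b P
    a+b≤c+d : a P + b P ≤ c P + d P
    1≤c+d   : + 1 ≤ c P + d P
    b<d     : b P < d P
    2≤d     : + 2 ≤ d P

Growth : ℤ → Mat2 → Mat2 → Set
Growth k Q R = (d Q - b Q ≤ d R - b R) × (d Q - c Q ≤ d R - c R)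
             × (k * (b Q - a Q) ≤ b R - a R) × (d Q < d R)

increasing⇒∣Q∣ᴹ≡Q : ∀ {Q} → Increasing Q → ∣ Q ∣ᴹ ≡ Q
increasing⇒∣Q∣ᴹ≡Q inc = mat-≡ (0≤i⇒+∣i∣≡i 0≤a) (0≤i⇒+∣i∣≡i 0≤b) (0≤i⇒+∣i∣≡i (≤-trans 0≤a a≤c))
                            (0≤i⇒+∣i∣≡i (≤-trans 0≤b (<⇒≤ b<d)))
  where
  open Increasing inc
  0≤b = ≤-trans 0≤a a≤b

module _ {P Q : Mat2} (adm : Admissible P) (inc : Increasing Q) where
  private
    open Admissible adm
    open Increasing inc
      renaming (0≤a to 0≤aQ; a≤b to aQ≤bQ; a≤c to aQ≤cQ; b+c≤a+d to bQ+cQ≤aQ+dQ; b<d to bQ<dQ)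
    0≤bQ-aQ       = i≤j⇒0≤j-i aQ≤bQ
    0≤cQ-aQ       = i≤j⇒0≤j-i aQ≤cQ
    0≤aQ+dQ-bQ-cQ = i≤j⇒0≤j-i bQ+cQ≤aQ+dQ
    0≤bQ          = ≤-trans 0≤aQ aQ≤bQ
    0≤dQ-bQ       = i≤j⇒0≤j-i (<⇒≤ bQ<dQ)
    0≤c+d-a-b     = i≤j⇒0≤j-i a+b≤c+d
    0≤c+d-1       = i≤j⇒0≤j-i 1≤c+d
    0≤d-b         = i≤j⇒0≤j-i (<⇒≤ b<d)
    0≤d-1         = i≤j⇒0≤j-i (≤-trans (+≤+ (s≤s z≤n)) 2≤d)
    0≤d-2         = i≤j⇒0≤j-i 2≤d

  ⊗-growth : ∀ k → k ≤ a P + b P → Growth k Q (P ⊗ Q)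
  ⊗-growth k k≤a+b = growth-db , growth-dc , growth-ba , growth-d
    where
    growth-db : d Q - b Q ≤ d (P ⊗ Q) - b (P ⊗ Q)
    growth-db = ≤-by (identity (a P) (b P) (c P) (d P) (b Q) (d Q))
                     (0≤+ (0≤* 0≤c+d-a-b 0≤bQ) (0≤* (<⇒0≤-1 b<d) 0≤dQ-bQ))
      where
      identity : ∀ a b c d y w → ((c * y + d * w) - (a * y + b * w)) - (w - y) ≡
                                 ((c + d) - (a + b)) * y + (d - (+ 1 + b)) * (w - y)
      identity = solve-∀
    growth-dc : d Q - c Q ≤ d (P ⊗ Q) - c (P ⊗ Q)
    growth-dc = ≤-by (identity (c P) (d P) (a Q) (b Q) (c Q) (d Q))
                     (0≤+ (0≤* 0≤c+d-1 0≤bQ-aQ) (0≤* 0≤d-1 0≤aQ+dQ-bQ-cQ))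
      where
      identity : ∀ c d x y z w → ((c * y + d * w) - (c * x + d * z)) - (w - z) ≡
                                 (c + d - + 1) * (y - x) + (d - + 1) * ((x + w) - (y + z))
      identity = solve-∀
    growth-ba : k * (b Q - a Q) ≤ b (P ⊗ Q) - a (P ⊗ Q)
    growth-ba = ≤-by (identity k (a P) (b P) (a Q) (b Q) (c Q) (d Q))
                     (0≤+ (0≤* (i≤j⇒0≤j-i k≤a+b) 0≤bQ-aQ) (0≤* 0≤b 0≤aQ+dQ-bQ-cQ))
      where
      identity : ∀ k a b x y z w → ((a * y + b * w) - (a * x + b * z)) - k * (y - x) ≡
                                   ((a + b) - k) * (y - x) + b * ((x + w) - (y + z))
      identity = solve-∀
    growth-d : d Q < d (P ⊗ Q)
    growth-d = <-by (identity (c P) (d P) (b Q) (d Q))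
                    (0≤+ (0≤+ (0≤* 0≤c+d-1 0≤bQ) (0≤* 0≤d-2 0≤dQ-bQ)) (<⇒0≤-1 bQ<dQ))
      where
      identity : ∀ c d y w → (c * y + d * w) - (+ 1 + w) ≡
                             (c + d - + 1) * y + (d - + 2) * (w - y) + (w - (+ 1 + y))
      identity = solve-∀

  ⊗-increasing : Increasing (P ⊗ Q)
  ⊗-increasing = record
    { 0≤a     = ≤-by (identity-a (a P) (b P) (a Q) (c Q)) (0≤+ (0≤* 0≤a+b 0≤aQ) (0≤* 0≤b 0≤cQ-aQ))
    ; a≤b     = ≤-by (identity-ab (a P) (b P) (a Q) (b Q) (c Q) (d Q)) (0≤+ (0≤* 0≤a+b 0≤bQ-aQ) (0≤* 0≤b 0≤aQ+dQ-bQ-cQ))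
    ; a≤c     = ≤-by (identity-ac (a P) (b P) (c P) (d P) (a Q) (c Q)) (0≤+ (0≤* 0≤c+d-a-b 0≤aQ) (0≤* 0≤d-b 0≤cQ-aQ))
    ; b+c≤a+d = ≤-by (identity-r (a P) (b P) (c P) (d P) (a Q) (b Q) (c Q) (d Q)) (0≤+ (0≤* 0≤c+d-a-b 0≤bQ-aQ) (0≤* 0≤d-b 0≤aQ+dQ-bQ-cQ))
    ; b<d     = <-by (identity-bd (a P) (b P) (c P) (d P) (b Q) (d Q))
                     (0≤+ (0≤+ (0≤* 0≤c+d-a-b 0≤bQ) (0≤* (<⇒0≤-1 b<d) 0≤dQ-bQ)) (<⇒0≤-1 bQ<dQ))
    }
    where
    identity-a : ∀ a b x z → (a * x + b * z) - 0ℤ ≡ (a + b) * x + b * (z - x)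
    identity-a = solve-∀
    identity-ab : ∀ a b x y z w → (a * y + b * w) - (a * x + b * z) ≡ (a + b) * (y - x) + b * ((x + w) - (y + z))
    identity-ab = solve-∀
    identity-ac : ∀ a b c d x z → (c * x + d * z) - (a * x + b * z) ≡ ((c + d) - (a + b)) * x + (d - b) * (z - x)
    identity-ac = solve-∀
    identity-r : ∀ a b c d x y z w →
                 ((a * x + b * z) + (c * y + d * w)) - ((a * y + b * w) + (c * x + d * z)) ≡
                 ((c + d) - (a + b)) * (y - x) + (d - b) * ((x + w) - (y + z))
    identity-r = solve-∀
    identity-bd : ∀ a b c d y w → (c * y + d * w) - (+ 1 + (a * y + b * w)) ≡
                  ((c + d) - (a + b)) * y + (d - (+ 1 + b)) * (w - y) + (w - (+ 1 + y))
    identity-bd = solve-∀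

PowerGrowth : Mat2 → ℕ → Set
PowerGrowth P i = Growth (abs (b P) - abs (a P)) ∣ P ^ᴹ i ∣ᴹ ∣ P ^ᴹ suc i ∣ᴹ

powers-growth : ∀ {P S} → P ≡ ∣ P ∣ᴹ ⊗ S → (∀ M → ∣ M ⊗ S ∣ᴹ ≡ ∣ M ∣ᴹ) →
                Admissible P → Increasing ∣ P ∣ᴹ → ∀ j → PowerGrowth P (suc j)
powers-growth {P} {S} P≡∣P∣⊗S ∣⊗S∣ᴹ adm inc j =
  subst₂ (Growth k) (sym (∣P^suc∣ᴹ j)) (trans (sym (Q-suc j)) (sym (∣P^suc∣ᴹ (suc j))))
         (⊗-growth adm (increasing j) k (∣b∣-∣a∣≤a+b (a P) (b P) (Admissible.0≤b adm)))
  where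
  k = abs (b P) - abs (a P)

  Q : ℕ → Mat2
  Q j = (P ^ᴹ j) ⊗ ∣ P ∣ᴹ

  Q-suc : ∀ j → Q (suc j) ≡ P ⊗ Q j
  Q-suc j = ⊗-assoc P (P ^ᴹ j) ∣ P ∣ᴹ

  increasing : ∀ j → Increasing (Q j)
  increasing zero    = subst Increasing (sym (⊗-identityˡ ∣ P ∣ᴹ)) inc
  increasing (suc j) = subst Increasing (sym (Q-suc j)) (⊗-increasing adm (increasing j))

  ∣P^suc∣ᴹ : ∀ j → ∣ P ^ᴹ suc j ∣ᴹ ≡ Q j
  ∣P^suc∣ᴹ j = begin
    ∣ P ^ᴹ suc j ∣ᴹ   ≡⟨ cong ∣_∣ᴹ (^ᴹ-suc-factor P≡∣P∣⊗S j) ⟩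
    ∣ Q j ⊗ S ∣ᴹ      ≡⟨ ∣⊗S∣ᴹ (Q j) ⟩
    ∣ Q j ∣ᴹ          ≡⟨ increasing⇒∣Q∣ᴹ≡Q (increasing j) ⟩
    Q j               ∎
    where open ≡-Reasoning

-- Consequences of unimodularity

record Bounds (M : Mat2) : Set where
  field
    b≢0 : b M ≢ 0ℤ
    2≤c : + 2 ≤ c M
    2≤d : + 2 ≤ d M
    a≤b : a M ≤ b M
    c≤d : c M ≤ d M
    a≤c : a M ≤ c M
    b≤d : b M ≤ d M

unit-det⇒1≤v+t : ∀ α u {v t} → 0ℤ ≤ v → 0ℤ ≤ t → IsUnit (α * t - u * v) → + 1 ≤ v + t
unit-det⇒1≤v+t α u {+ zero}  {+ zero}  _ _ unit = contradiction (subst IsUnit (det-zero α u) unit) unit≢0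
  where
  det-zero : ∀ α u → α * + 0 - u * + 0 ≡ 0ℤ
  det-zero = solve-∀
unit-det⇒1≤v+t α u {+ zero}  {+ suc n} _ _ _ = +≤+ (s≤s z≤n)
unit-det⇒1≤v+t α u {+ suc m} {+ n}     _ _ _ = +≤+ (s≤s z≤n)

-- With t = (A + D) - (B + C) we have det = A t - (B - A)(C - A).  If t < 0 this is at most
-- -C ≤ -2; if t ≥ 0, neither D - B = (C - A) + t nor D - C = (B - A) + t can vanish without det = 0.
unimodular⇒increasing : ∀ {M} → 0ℤ ≤ a M → Bounds M → IsUnit (det M) → Increasing M × c M < d M
unimodular⇒increasing {mat A B C D} 0≤A bounds unit =
  record { 0≤a = 0≤A ; a≤b = a≤b ; a≤c = a≤c ; b+c≤a+d = b+c≤a+d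
         ; b<d = <-by-gap (gap-db A B C D)
                          (unit-det⇒1≤v+t A (B - A) 0≤C-A 0≤t (subst IsUnit (det-bd A B C D) unit)) } ,
  <-by-gap (gap-dc A B C D) (unit-det⇒1≤v+t A (C - A) 0≤B-A 0≤t (subst IsUnit (det-cd A B C D) unit))
  where
  open Bounds bounds
  b+c≤a+d : B + C ≤ A + D
  b+c≤a+d with B + C ≤? A + D
  ... | yes b+c≤a+d = b+c≤a+d
  ... | no  b+c≰a+d = contradiction det≤-2 (unit≰-2 unit)
    where
    0≤m = <⇒0≤-1 (≰⇒> b+c≰a+d)
    det≤-2 : A * D - B * C ≤ - (+ 2)
    det≤-2 = ≤-by (identity A B C D)
                  (0≤+ (0≤+ (0≤* 0≤A 0≤m) (0≤* (0≤+ (i≤j⇒0≤j-i c≤d) 0≤m) (i≤j⇒0≤j-i a≤c))) (i≤j⇒0≤j-i 2≤c))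
      where
      identity : ∀ A B C D → - (+ 2) - (A * D - B * C) ≡
                 A * ((B + C) - (+ 1 + (A + D))) + ((D - C) + ((B + C) - (+ 1 + (A + D)))) * (C - A) + (C - + 2)
      identity = solve-∀
  0≤t = i≤j⇒0≤j-i b+c≤a+d
  0≤B-A = i≤j⇒0≤j-i a≤b
  0≤C-A = i≤j⇒0≤j-i a≤c
  gap-db : ∀ A B C D → D - B ≡ (C - A) + ((A + D) - (B + C))
  gap-db = solve-∀
  gap-dc : ∀ A B C D → D - C ≡ (B - A) + ((A + D) - (B + C))
  gap-dc = solve-∀
  det-bd : ∀ A B C D → A * D - B * C ≡ A * ((A + D) - (B + C)) - (B - A) * (C - A)
  det-bd = solve-∀
  det-cd : ∀ A B C D → A * D - B * C ≡ A * ((A + D) - (B + C)) - (C - A) * (B - A)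
  det-cd = solve-∀

admissible : ∀ {M} → Bounds M → Increasing M → Admissible M
admissible {M} bounds inc = record
  { 0≤b = 0≤b ; 0≤a+b = 0≤+ 0≤a 0≤b ; a+b≤c+d = +-mono-≤ a≤c b≤d
  ; 1≤c+d = ≤-trans (+≤+ (s≤s z≤n)) (≤-trans 2≤d (i≤j⇒i≤k+j (c M) {{nonNegative (≤-trans 0≤a a≤c)}} ≤-refl))
  ; b<d = b<d ; 2≤d = 2≤d }
  where
  open Bounds bounds using (2≤d; b≤d)
  open Increasing inc
  0≤b = ≤-trans 0≤a a≤b

admissible-flip : ∀ {M} → Bounds M → Increasing M → c M < d M → Admissible (mat (- a M) (b M) (- c M) (d M))
admissible-flip {M} bounds inc c<d = record
  { 0≤b     = ≤-trans 0≤a a≤b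
  ; 0≤a+b   = ≤-by (gap-ab (a M) (b M)) (i≤j⇒0≤j-i a≤b)
  ; a+b≤c+d = ≤-by (gap-ab-cd (a M) (b M) (c M) (d M)) (i≤j⇒0≤j-i b+c≤a+d)
  ; 1≤c+d   = ≤-by (gap-cd (c M) (d M)) (<⇒0≤-1 c<d)
  ; b<d = b<d ; 2≤d = 2≤d }
  where
  open Bounds bounds using (2≤d)
  open Increasing inc
  gap-ab : ∀ a b → (- a + b) - 0ℤ ≡ b - a
  gap-ab = solve-∀
  gap-ab-cd : ∀ a b c d → (- c + d) - (- a + b) ≡ (a + d) - (b + c)
  gap-ab-cd = solve-∀
  gap-cd : ∀ c d → (- c + d) - + 1 ≡ d - (+ 1 + c)
  gap-cd = solve-∀

mixed-signs-not-unit : ∀ p q β r → 2 ≤ℕ r → ¬ IsUnit (+ p * + q + + suc β * + r)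
mixed-signs-not-unit p q β r 2≤r unit = 2≰unit unit 2≤det
  where
  2≤det : + 2 ≤ + p * + q + + suc β * + r
  2≤det = subst (+ 2 ≤_) (trans (pos-+ (p ℕ.* q) (suc β ℕ.* r)) (cong₂ _+_ (pos-* p q) (pos-* (suc β) r)))
                (+≤+ (≤ℕ-trans (≤ℕ-trans 2≤r (m≤n*m r (suc β))) (m≤n+m _ (p ℕ.* q))))

growth-normalised : ∀ P → 0ℤ ≤ b P → 0ℤ ≤ d P → Bounds ∣ P ∣ᴹ → IsUnit (det P) → ∀ j → PowerGrowth P (suc j)
growth-normalised (mat a₀ -[1+ β ] c₀ d₀) () _ _ _
growth-normalised (mat a₀ (+ β) c₀ -[1+ δ ]) _ () _ _
growth-normalised (mat (+ α) (+ β) (+ γ) (+ δ)) _ _ bounds unit =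
  powers-growth (sym (⊗-identityʳ _)) ∣⊗I₂∣ᴹ (admissible bounds inc) inc
  where
  inc = proj₁ (unimodular⇒increasing (+≤+ z≤n) bounds unit)
growth-normalised (mat -[1+ α ] (+ β) -[1+ γ ] (+ δ)) _ _ bounds unit =
  powers-growth (sym (⊗-J _)) ∣⊗J∣ᴹ (admissible-flip bounds inc c<d) inc
  where
  det-flip : ∀ A B C D → - A * D - B * - C ≡ - (A * D - B * C)
  det-flip = solve-∀
  ∣P∣-unit = IsUnit-neg (subst IsUnit (det-flip (+ suc α) (+ β) (+ suc γ) (+ δ)) unit)
  inc = proj₁ (unimodular⇒increasing (+≤+ z≤n) bounds ∣P∣-unit)
  c<d = proj₂ (unimodular⇒increasing (+≤+ z≤n) bounds ∣P∣-unit)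
growth-normalised (mat (+ α) (+ zero) -[1+ γ ] (+ δ)) _ _ bounds _ = contradiction refl (Bounds.b≢0 bounds)
growth-normalised (mat (+ α) (+ suc β) -[1+ γ ] (+ δ)) _ _ bounds unit =
  contradiction (subst IsUnit (det-mixed (+ α) (+ δ) (+ suc β) (+ suc γ)) unit)
                (mixed-signs-not-unit α δ β (suc γ) (drop‿+≤+ (Bounds.2≤c bounds)))
  where
  det-mixed : ∀ A D B C → A * D - B * - C ≡ A * D + B * C
  det-mixed = solve-∀
growth-normalised (mat -[1+ α ] (+ zero) (+ γ) (+ δ)) _ _ bounds _ = contradiction refl (Bounds.b≢0 bounds)
growth-normalised (mat -[1+ α ] (+ suc β) (+ γ) (+ δ)) _ _ bounds unit =
  contradiction (IsUnit-neg (subst IsUnit (det-mixed (+ suc α) (+ δ) (+ suc β) (+ γ)) unit))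
                (mixed-signs-not-unit (suc α) δ β γ (drop‿+≤+ (Bounds.2≤c bounds)))
  where
  det-mixed : ∀ A D B C → - A * D - B * C ≡ - (A * D + B * C)
  det-mixed = solve-∀

-- Reduction to nonnegative b and d

conjᴹ : Mat2 → Mat2
conjᴹ M = mat (a M) (- b M) (- c M) (d M)

negᴹ : Mat2 → Mat2
negᴹ M = mat (- a M) (- b M) (- c M) (- d M)

conjᴹ-⊗ : ∀ M N → conjᴹ M ⊗ conjᴹ N ≡ conjᴹ (M ⊗ N)
conjᴹ-⊗ M N = mat-≡ (even (a M) (a N) (b M) (c N)) (odd (a M) (b N) (b M) (d N))
                    (odd′ (c M) (a N) (d M) (c N)) (even′ (c M) (b N) (d M) (d N))
  where
  even : ∀ x y z w → x * y + (- z) * (- w) ≡ x * y + z * w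
  even = solve-∀
  odd : ∀ x y z w → x * (- y) + (- z) * w ≡ - (x * y + z * w)
  odd = solve-∀
  odd′ : ∀ x y z w → (- x) * y + z * (- w) ≡ - (x * y + z * w)
  odd′ = solve-∀
  even′ : ∀ x y z w → (- x) * (- y) + z * w ≡ x * y + z * w
  even′ = solve-∀

negᴹ-⊗ : ∀ M N → negᴹ M ⊗ N ≡ negᴹ (M ⊗ N)
negᴹ-⊗ M N = mat-≡ (odd (a M) (a N) (b M) (c N)) (odd (a M) (b N) (b M) (d N))
                   (odd (c M) (a N) (d M) (c N)) (odd (c M) (b N) (d M) (d N))
  where
  odd : ∀ x y z w → (- x) * y + (- z) * w ≡ - (x * y + z * w)
  odd = solve-∀

negᴹ-⊗-negᴹ : ∀ M N → negᴹ M ⊗ negᴹ N ≡ M ⊗ N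
negᴹ-⊗-negᴹ M N = mat-≡ (even (a M) (a N) (b M) (c N)) (even (a M) (b N) (b M) (d N))
                        (even (c M) (a N) (d M) (c N)) (even (c M) (b N) (d M) (d N))
  where
  even : ∀ x y z w → (- x) * (- y) + (- z) * (- w) ≡ x * y + z * w
  even = solve-∀

conjᴹ-^ᴹ : ∀ P i → conjᴹ P ^ᴹ i ≡ conjᴹ (P ^ᴹ i)
conjᴹ-^ᴹ P zero    = refl
conjᴹ-^ᴹ P (suc i) = trans (cong (conjᴹ P ⊗_) (conjᴹ-^ᴹ P i)) (conjᴹ-⊗ P (P ^ᴹ i))

negᴹ-^ᴹ : ∀ P i → (negᴹ P ^ᴹ i ≡ P ^ᴹ i) ⊎ (negᴹ P ^ᴹ i ≡ negᴹ (P ^ᴹ i))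
negᴹ-^ᴹ P zero = inj₁ refl
negᴹ-^ᴹ P (suc i) with negᴹ-^ᴹ P i
... | inj₁ even = inj₂ (trans (cong (negᴹ P ⊗_) even) (negᴹ-⊗ P (P ^ᴹ i)))
... | inj₂ odd  = inj₁ (trans (cong (negᴹ P ⊗_) odd) (negᴹ-⊗-negᴹ P (P ^ᴹ i)))

∣conjᴹ∣ᴹ : ∀ M → ∣ conjᴹ M ∣ᴹ ≡ ∣ M ∣ᴹ
∣conjᴹ∣ᴹ M = mat-≡ refl (cong +_ (∣-i∣≡∣i∣ (b M))) (cong +_ (∣-i∣≡∣i∣ (c M))) refl

∣negᴹ∣ᴹ : ∀ M → ∣ negᴹ M ∣ᴹ ≡ ∣ M ∣ᴹ
∣negᴹ∣ᴹ M = mat-≡ (cong +_ (∣-i∣≡∣i∣ (a M))) (cong +_ (∣-i∣≡∣i∣ (b M)))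
                  (cong +_ (∣-i∣≡∣i∣ (c M))) (cong +_ (∣-i∣≡∣i∣ (d M)))

∣conjᴹ^ᴹ∣ᴹ : ∀ P i → ∣ conjᴹ P ^ᴹ i ∣ᴹ ≡ ∣ P ^ᴹ i ∣ᴹ
∣conjᴹ^ᴹ∣ᴹ P i = trans (cong ∣_∣ᴹ (conjᴹ-^ᴹ P i)) (∣conjᴹ∣ᴹ (P ^ᴹ i))

∣negᴹ^ᴹ∣ᴹ : ∀ P i → ∣ negᴹ P ^ᴹ i ∣ᴹ ≡ ∣ P ^ᴹ i ∣ᴹ
∣negᴹ^ᴹ∣ᴹ P i with negᴹ-^ᴹ P i
... | inj₁ even = cong ∣_∣ᴹ even
... | inj₂ odd  = trans (cong ∣_∣ᴹ odd) (∣negᴹ∣ᴹ (P ^ᴹ i))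

det-conjᴹ : ∀ M → det (conjᴹ M) ≡ det M
det-conjᴹ M = identity (a M) (b M) (c M) (d M)
  where
  identity : ∀ x y z w → x * w - (- y) * (- z) ≡ x * w - y * z
  identity = solve-∀

det-negᴹ : ∀ M → det (negᴹ M) ≡ det M
det-negᴹ M = identity (a M) (b M) (c M) (d M)
  where
  identity : ∀ x y z w → (- x) * (- w) - (- y) * (- z) ≡ x * w - y * z
  identity = solve-∀

record SignNormalisation (P : Mat2) : Set where
  field
    P′       : Mat2
    0≤b      : 0ℤ ≤ b P′
    0≤d      : 0ℤ ≤ d P′
    det≡     : det P′ ≡ det P
    ∣^ᴹ∣ᴹ≡   : ∀ i → ∣ P′ ^ᴹ i ∣ᴹ ≡ ∣ P ^ᴹ i ∣ᴹ

sign-normalise : ∀ P → SignNormalisation P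
sign-normalise P@(mat a₀ (+ β) c₀ (+ δ)) = record
  { P′ = P ; 0≤b = +≤+ z≤n ; 0≤d = +≤+ z≤n ; det≡ = refl ; ∣^ᴹ∣ᴹ≡ = λ _ → refl }
sign-normalise P@(mat a₀ -[1+ β ] c₀ (+ δ)) = record
  { P′ = conjᴹ P ; 0≤b = +≤+ z≤n ; 0≤d = +≤+ z≤n ; det≡ = det-conjᴹ P ; ∣^ᴹ∣ᴹ≡ = ∣conjᴹ^ᴹ∣ᴹ P }
sign-normalise P@(mat a₀ -[1+ β ] c₀ -[1+ δ ]) = record
  { P′ = negᴹ P ; 0≤b = +≤+ z≤n ; 0≤d = +≤+ z≤n ; det≡ = det-negᴹ P ; ∣^ᴹ∣ᴹ≡ = ∣negᴹ^ᴹ∣ᴹ P }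
sign-normalise P@(mat a₀ (+ β) c₀ -[1+ δ ]) = record
  { P′     = negᴹ (conjᴹ P)
  ; 0≤b    = subst (0ℤ ≤_) (sym (neg-involutive (+ β))) (+≤+ z≤n)
  ; 0≤d    = +≤+ z≤n
  ; det≡   = trans (det-negᴹ (conjᴹ P)) (det-conjᴹ P)
  ; ∣^ᴹ∣ᴹ≡ = λ i → trans (∣negᴹ^ᴹ∣ᴹ (conjᴹ P) i) (∣conjᴹ^ᴹ∣ᴹ P i) }

∣^ᴹ∣ᴹ≡⇒∣∣ᴹ≡ : ∀ {P P′} → (∀ i → ∣ P ^ᴹ i ∣ᴹ ≡ ∣ P′ ^ᴹ i ∣ᴹ) → ∣ P ∣ᴹ ≡ ∣ P′ ∣ᴹ
∣^ᴹ∣ᴹ≡⇒∣∣ᴹ≡ {P} {P′} ∣^ᴹ∣ᴹ≡ = trans (sym (∣⊗I₂∣ᴹ P)) (trans (∣^ᴹ∣ᴹ≡ 1) (∣⊗I₂∣ᴹ P′))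

PowerGrowth-cong : ∀ {P P′} → (∀ i → ∣ P ^ᴹ i ∣ᴹ ≡ ∣ P′ ^ᴹ i ∣ᴹ) → ∀ i → PowerGrowth P i → PowerGrowth P′ i
PowerGrowth-cong {P} {P′} ∣^ᴹ∣ᴹ≡ i growth =
  subst₂ (Growth (b ∣ P′ ∣ᴹ - a ∣ P′ ∣ᴹ)) (∣^ᴹ∣ᴹ≡ i) (∣^ᴹ∣ᴹ≡ (suc i))
         (subst (λ M → Growth (b M - a M) ∣ P ^ᴹ i ∣ᴹ ∣ P ^ᴹ suc i ∣ᴹ) (∣^ᴹ∣ᴹ≡⇒∣∣ᴹ≡ ∣^ᴹ∣ᴹ≡) growth)

lemma2p4 : (P : Mat2) →
    + 2 ≤ abs (c P) → + 2 ≤ abs (d P) → b P ≢ + 0 →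
    (det P ≡ + 1 ⊎ det P ≡ - (+ 1)) →
    abs (a P) ≤ abs (b P) → abs (c P) ≤ abs (d P) →
    abs (a P) ≤ abs (c P) → abs (b P) ≤ abs (d P) →
    (i : ℕ) → 1 ≤ℕ i →
    (abs (d (P ^ᴹ i)) - abs (b (P ^ᴹ i)) ≤ abs (d (P ^ᴹ suc i)) - abs (b (P ^ᴹ suc i)))
    × (abs (d (P ^ᴹ i)) - abs (c (P ^ᴹ i)) ≤ abs (d (P ^ᴹ suc i)) - abs (c (P ^ᴹ suc i)))
    × ((abs (b P) - abs (a P)) * (abs (b (P ^ᴹ i)) - abs (a (P ^ᴹ i))) ≤ abs (b (P ^ᴹ suc i)) - abs (a (P ^ᴹ suc i)))
    × (abs (d (P ^ᴹ i)) < abs (d (P ^ᴹ suc i)))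
lemma2p4 P 2≤c 2≤d b≢0 unit a≤b c≤d a≤c b≤d (suc j) _ =
  PowerGrowth-cong ∣^ᴹ∣ᴹ≡ (suc j) (growth-normalised P′ 0≤b 0≤d bounds′ (subst IsUnit (sym det≡) unit) j)
  where
  open SignNormalisation (sign-normalise P)
  bounds : Bounds ∣ P ∣ᴹ
  bounds = record { b≢0 = λ ∣b∣≡0 → b≢0 (∣i∣≡0⇒i≡0 (+-injective ∣b∣≡0))
                  ; 2≤c = 2≤c ; 2≤d = 2≤d ; a≤b = a≤b ; c≤d = c≤d ; a≤c = a≤c ; b≤d = b≤d }
  bounds′ : Bounds ∣ P′ ∣ᴹ
  bounds′ = subst Bounds (sym (∣^ᴹ∣ᴹ≡⇒∣∣ᴹ≡ ∣^ᴹ∣ᴹ≡)) bounds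
lemma2p4 _ _ _ _ _ _ _ _ _ zero ()
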